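{- Let $G$ and $H$ be graphs, let $e_1,e_2$ be parallel edges of $G$ and $f_1,f_2$ be parallel edges of $H$. If both $G\backslash\{e_1,e_2\}$ and $H\backslash\{f_1,f_2\}$ are connected, then any two of the following three equalities imply the third: (1) $T_{G\backslash\{e_1,e_2\}}(x,y)=T_{H\backslash\{f_1,f_2\}}(x,y)$; (2) $T_{G\backslash e_1}(x,y)=T_{H\backslash f_1}(x,y)$; (3) $T_G(x,y)=T_H(x,y)$.
   Context: Graphs may have loops and parallel edges; two edges are parallel if they have the same pair of ends. For $G=(V,E)$, the Tutte polynomial is $T_G(x,y)=\sum_{A\subseteq E}(x-1)^{r(E)-r(A)}(y-1)^{|A|-r(A)}$, where $r(A)=|V|-c(A)$ and $c(A)$ is the number of components of $(V,A)$. $G\backslash A$ is $G$ with the edges of $A$ deleted, and $G\backslash e=G\backslash\{e\}$. -}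

module Defs where

open import Data.Nat using (ℕ; zero; suc; _∸_) renaming (_+_ to _+ℕ_)
open import Data.Integer using (ℤ; +_; _-_; _*_; _+_; _^_; 1ℤ)
open import Data.Fin using (Fin; toℕ)
open import Data.Fin.Properties using () renaming (_≟_ to _≟F_)
open import Data.List using (List; []; _∷_; length; map; _++_; foldr; allFin)
open import Data.Bool using (Bool; true; false; not; _∧_; _∨_; if_then_else_)
open import Data.Product using (_×_; _,_; proj₁; proj₂)
open import Data.Sum using (_⊎_)
open import Relation.Nullary.Decidable using (⌊_⌋)
open import Relation.Binary.PropositionalEquality using (_≡_)

-- Loops (u , u) and parallel edges
-- (repeated entries) are allowed.  Edges are identified by their position
-- in the list.
record Graph : Set where
  constructor graph
  field
    n     : ℕ
    edges : List (Fin n × Fin n)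
open Graph public

Edge : Graph → Set
Edge G = Fin (length (edges G))

ends : (G : Graph) → Edge G → Fin (n G) × Fin (n G)
ends G i = Data.List.lookup (edges G) i

Parallel : (G : Graph) → Edge G → Edge G → Set
Parallel G e f =
  (proj₁ (ends G e) ≡ proj₁ (ends G f) × proj₂ (ends G e) ≡ proj₂ (ends G f))
  ⊎ (proj₁ (ends G e) ≡ proj₂ (ends G f) × proj₂ (ends G e) ≡ proj₁ (ends G f))

keepIdx : {A : Set} (xs : List A) → (Fin (length xs) → Bool) → List A
keepIdx []       p = []
keepIdx (x ∷ xs) p =
  if p Fin.zero then x ∷ keepIdx xs (λ i → p (Fin.suc i)) else keepIdx xs (λ i → p (Fin.suc i))

_==_ : {k : ℕ} → Fin k → Fin k → Bool
a == b = ⌊ a ≟F b ⌋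

delete1 : (G : Graph) → Edge G → Graph
delete1 G e = graph (n G) (keepIdx (edges G) (λ i → not (i == e)))

delete2 : (G : Graph) → Edge G → Edge G → Graph
delete2 G e f = graph (n G) (keepIdx (edges G) (λ i → not ((i == e) ∨ (i == f))))

-- all subsets of a list of edges (as sublists; each subset of positions
-- appears exactly once)
subsets : {A : Set} → List A → List (List A)
subsets []       = [] ∷ []
subsets (x ∷ xs) = map (x ∷_) (subsets xs) ++ subsets xs

anyL : {A : Set} → (A → Bool) → List A → Bool
anyL p = foldr (λ a b → p a ∨ b) false

countL : {A : Set} → (A → Bool) → List A → ℕ
countL p = foldr (λ a k → if p a then suc k else k) 0

reach : {m : ℕ} → ℕ → List (Fin m × Fin m) → Fin m → Fin m → Bool
reach zero    A u v = u == v
reach (suc k) A u v =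
  reach k A u v ∨
  anyL (λ ab → (reach k A u (proj₁ ab) ∧ (v == proj₂ ab))
             ∨ (reach k A u (proj₂ ab) ∧ (v == proj₁ ab))) A

-- u and v lie in the same component of (Fin m , A); walks of length ≤ m
-- suffice since a shortest walk is a path.
sameComp : {m : ℕ} → List (Fin m × Fin m) → Fin m → Fin m → Bool
sameComp {m} A u v = reach m A u v

-- number of components of (Fin m , A): the number of vertices that are the
-- least vertex of their component
comps : (m : ℕ) → List (Fin m × Fin m) → ℕ
comps m A = countL (λ v → not (anyL (λ u → ⌊ Data.Fin._<?_ u v ⌋ ∧ sameComp A u v) (allFin m)))
                   (allFin m)

rank : (m : ℕ) → List (Fin m × Fin m) → ℕ
rank m A = m ∸ comps m A

Connected : Graph → Set
Connected G = comps (n G) (edges G) ≡ 1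

sumℤ : List ℤ → ℤ
sumℤ = foldr _+_ (+ 0)

tutte : Graph → ℤ → ℤ → ℤ
tutte G x y =
  sumℤ (map (λ A → ((x - 1ℤ) ^ (rank (n G) (edges G) ∸ rank (n G) A))
                 * ((y - 1ℤ) ^ (length A ∸ rank (n G) A)))
            (subsets (edges G)))

-- equality of Tutte polynomials (as polynomials in ℤ[x,y], equivalently
-- as functions on ℤ²)
_≡T_ : Graph → Graph → Set
G ≡T H = ∀ (x y : ℤ) → tutte G x y ≡ tutte H x y

module Submission where

-- Sort the edge sets A ⊆ E(G) in the Tutte sum by how they meet the parallel pair {e₁ , e₂}.
-- Since G \ {e₁ , e₂} is connected, all the top ranks r(E) involved equal |V| - 1, and since
-- e₁ ∥ e₂, adding e₁ to a set containing e₂ does not change its rank.  So the sets containing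
-- exactly one of the two edges contribute equally, those containing both contribute y - 1 times
-- as much as the same set without e₁, and
--   T_G = (1 + y) T_{G \ e₁} - y T_{G \ {e₁ , e₂}}.
-- This relation, for G and for H, turns (1) and (2) into (3).  Conversely (3) with (1) or (2)
-- gives the third equality after cancelling 1 + y or y, that is for y ≠ -1 or y ≠ 0; the
-- missing value of y follows because both sides are polynomial in y.

open import Data.Nat as ℕ using (ℕ; zero; suc; _≤_; _<_; z≤n; s≤s; _≤′_; ≤′-refl; ≤′-step; _∸_; _⊔_)
import Data.Nat.Properties as ℕ
open import Data.Integer as ℤ using (ℤ; +_; -_; 0ℤ; 1ℤ; -1ℤ; _+_; _-_; _*_; _^_; ≢-nonZero)
import Data.Integer.Properties as ℤ
open import Data.Integer.Tactic.RingSolver using (solve-∀)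
open import Algebra.Properties.CommutativeSemigroup ℤ.+-commutativeSemigroup using (interchange)
open import Data.Bool using (Bool; true; false; not; _∧_; _∨_; T)
open import Data.Bool.Properties using (T-∧; T-∨; T-≡; T-not-≡; T?; ∨-identityʳ; ∨-zeroʳ)
open import Data.Fin as Fin using (Fin; _≟_; _<?_)
import Data.Fin.Properties as Fin
open import Data.Fin.Subset using (Subset; _∈_; _∉_; _⊆_; ∣_∣; ⁅_⁆; _∪_; ⊤; inside; outside)
open import Data.Fin.Subset.Properties as Subset using (_⊂?_)
open import Data.List as List using (List; []; _∷_; _++_; map; length; lookup; allFin)
import Data.List.Properties as List
open import Data.List.Membership.Propositional using (find; lose) renaming (_∈_ to _∈ₗ_)
open import Data.List.Membership.Propositional.Properties using (∈-allFin)
open import Data.List.Relation.Binary.Permutation.Propositional as ↭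
  using (_↭_; prep; swap; ↭-refl; ↭-reflexive; ↭-sym; ↭-trans)
open import Data.List.Relation.Binary.Permutation.Propositional.Properties using (∈-resp-↭; ↭-length)
open import Data.List.Relation.Unary.Any as Any using (Any; here; there)
open import Data.Product as Prod using (∃; _×_; _,_; proj₂)
open import Data.Sum as Sum using (_⊎_; inj₁; inj₂)
open import Data.Empty using (⊥)
open import Data.Vec using (tabulate; []; _∷_)
open import Data.Vec.Properties using (lookup∘tabulate; lookup⇒[]=; []=⇒lookup)
open import Function using (_∘_; id; _⇔_; mk⇔; Equivalence)
open Equivalence using (to; from)
open import Relation.Binary.Definitions using (tri<; tri≈; tri>)
open import Relation.Nullary using (¬_; yes; no; contradiction; _×-dec_; ¬?)
open import Relation.Nullary.Decidable using (⌊_⌋; toWitness; fromWitness)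
open import Relation.Binary.PropositionalEquality

open import Defs

-- Polynomial functions ℤ → ℤ

Δ : (ℤ → ℤ) → ℤ → ℤ
Δ f y = f (y + 1ℤ) - f y

data Degree< : ℕ → (ℤ → ℤ) → Set where
  vanishing : ∀ {f} → (∀ y → f y ≡ 0ℤ) → Degree< zero f
  Δ-degree< : ∀ {d f} → Degree< d (Δ f) → Degree< (suc d) f

Polynomial : (ℤ → ℤ) → Set
Polynomial f = ∃ λ d → Degree< d f

private
  variable
    d d′ : ℕ
    f g : ℤ → ℤ

  Degree<-cong : (∀ y → f y ≡ g y) → Degree< d f → Degree< d g
Degree<-cong f≗g (vanishing p) = vanishing λ y → trans (sym (f≗g y)) (p y)
Degree<-cong f≗g (Δ-degree< p) = Δ-degree< (Degree<-cong (λ y → cong₂ _-_ (f≗g (y + 1ℤ)) (f≗g y)) p)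

Degree<-suc : Degree< d f → Degree< (suc d) f
Degree<-suc (vanishing p) = Δ-degree< (vanishing λ y → cong₂ _-_ (p (y + 1ℤ)) (p y))
Degree<-suc (Δ-degree< p) = Δ-degree< (Degree<-suc p)

Degree<-mono : d ≤ d′ → Degree< d f → Degree< d′ f
Degree<-mono {d′ = zero}  z≤n p = p
Degree<-mono {d′ = suc d′} z≤n p = Degree<-suc (Degree<-mono z≤n p)
Degree<-mono (s≤s d≤d′) (Δ-degree< p) = Δ-degree< (Degree<-mono d≤d′ p)

Degree<-+ : Degree< d f → Degree< d g → Degree< d (λ y → f y + g y)
Degree<-+ (vanishing p) (vanishing q) = vanishing λ y → cong₂ _+_ (p y) (q y)
Degree<-+ {f = f} {g} (Δ-degree< p) (Δ-degree< q) =
  Δ-degree< (Degree<-cong (λ y → lemma (f (y + 1ℤ)) (g (y + 1ℤ)) (f y) (g y)) (Degree<-+ p q))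
  where
  lemma : ∀ a b c d → (a - c) + (b - d) ≡ (a + b) - (c + d)
  lemma = solve-∀

Degree<-- : Degree< d f → Degree< d g → Degree< d (λ y → f y - g y)
Degree<-- (vanishing p) (vanishing q) = vanishing λ y → cong₂ _-_ (p y) (q y)
Degree<-- {f = f} {g} (Δ-degree< p) (Δ-degree< q) =
  Δ-degree< (Degree<-cong (λ y → lemma (f (y + 1ℤ)) (g (y + 1ℤ)) (f y) (g y)) (Degree<-- p q))
  where
  lemma : ∀ a b c d → (a - c) - (b - d) ≡ (a - b) - (c - d)
  lemma = solve-∀

Degree<-shift : Degree< d f → Degree< d (λ y → f (y + 1ℤ))
Degree<-shift (vanishing p) = vanishing λ y → p (y + 1ℤ)
Degree<-shift (Δ-degree< p) = Δ-degree< (Degree<-shift p)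

Degree<-const : ∀ c → Degree< 1 (λ _ → c)
Degree<-const c = Δ-degree< (vanishing λ _ → ℤ.+-inverseʳ c)

-- Δ((y - a) f) = (y - a) Δf + f(y + 1)
Degree<-*-linear : ∀ a → Degree< d f → Degree< (suc d) (λ y → (y - a) * f y)
Degree<-*-linear a (vanishing p) =
  Degree<-cong (λ y → trans (sym (ℤ.*-zeroʳ (y - a))) (cong ((y - a) *_) (sym (p y)))) (Degree<-const 0ℤ)
Degree<-*-linear {f = f} a (Δ-degree< p) = Δ-degree<
  (Degree<-cong (λ y → lemma y a (f (y + 1ℤ)) (f y))
    (Degree<-+ (Degree<-*-linear a p) (Degree<-shift {f = f} (Δ-degree< p))))
  where
  lemma : ∀ y a u v → (y - a) * (u - v) + u ≡ (y + 1ℤ - a) * u - (y - a) * v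
  lemma = solve-∀

Degree<-monomial : ∀ c a q → Degree< (suc q) (λ y → c * (y - a) ^ q)
Degree<-monomial c a zero = Degree<-cong (λ _ → sym (ℤ.*-identityʳ c)) (Degree<-const c)
Degree<-monomial c a (suc q) =
  Degree<-cong (λ y → lemma c (y - a) ((y - a) ^ q)) (Degree<-*-linear a (Degree<-monomial c a q))
  where
  lemma : ∀ c z w → z * (c * w) ≡ c * (z * w)
  lemma = solve-∀

Degree<-vanishes : ∀ y₀ → Degree< d f → (∀ k → f (y₀ + + suc k) ≡ 0ℤ) → f y₀ ≡ 0ℤ
Degree<-vanishes y₀ (vanishing p) _ = p y₀
Degree<-vanishes {f = f} y₀ (Δ-degree< p) f≡0 = begin
  f y₀                   ≡⟨ ℤ.neg-involutive (f y₀) ⟨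
  - (- f y₀)             ≡⟨ cong -_ (ℤ.+-identityˡ (- f y₀)) ⟨
  - (0ℤ - f y₀)          ≡⟨ cong (λ z → - (z - f y₀)) (f≡0 0) ⟨
  - Δ f y₀               ≡⟨ cong -_ (Degree<-vanishes y₀ p Δf≡0) ⟩
  0ℤ                     ∎
  where
  open ≡-Reasoning
  Δf≡0 : ∀ k → Δ f (y₀ + + suc k) ≡ 0ℤ
  Δf≡0 k rewrite ℤ.+-assoc y₀ (+ suc k) 1ℤ | ℕ.+-comm (suc k) 1 | f≡0 (suc k) | f≡0 k = refl

Polynomial-- : Polynomial f → Polynomial g → Polynomial (λ y → f y - g y)
Polynomial-- (d , p) (d′ , q) =
  d ⊔ d′ , Degree<-- (Degree<-mono (ℕ.m≤m⊔n d d′) p) (Degree<-mono (ℕ.m≤n⊔m d d′) q)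

Polynomial-+ : Polynomial f → Polynomial g → Polynomial (λ y → f y + g y)
Polynomial-+ (d , p) (d′ , q) =
  d ⊔ d′ , Degree<-+ (Degree<-mono (ℕ.m≤m⊔n d d′) p) (Degree<-mono (ℕ.m≤n⊔m d d′) q)

Polynomial-sum : {A : Set} (c : A → ℤ) (a : ℤ) (q : A → ℕ) (xs : List A) →
                 Polynomial (λ y → sumℤ (map (λ x → c x * (y - a) ^ q x) xs))
Polynomial-sum c a q []       = 1 , Degree<-const 0ℤ
Polynomial-sum c a q (x ∷ xs) = Polynomial-+ (_ , Degree<-monomial (c x) a (q x)) (Polynomial-sum c a q xs)

i+j≡i⇒j≡0 : ∀ {i j} → i + j ≡ i → j ≡ 0ℤ
i+j≡i⇒j≡0 {i} {j} eq = begin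
  j            ≡⟨ j≡i+j-i i j ⟩
  i + j - i    ≡⟨ cong (_- i) eq ⟩
  i - i        ≡⟨ ℤ.+-inverseʳ i ⟩
  0ℤ           ∎
  where
  open ≡-Reasoning
  j≡i+j-i : ∀ i j → j ≡ i + j - i
  j≡i+j-i = solve-∀

-- f - g vanishes at every y₀ + k + 1, hence at y₀
Polynomial-≡-at : ∀ y₀ → Polynomial f → Polynomial g → (∀ y → y ≢ y₀ → f y ≡ g y) → f y₀ ≡ g y₀
Polynomial-≡-at {f} {g} y₀ pf pg f≡g = ℤ.i-j≡0⇒i≡j (f y₀) (g y₀)
  (Degree<-vanishes y₀ (proj₂ (Polynomial-- pf pg)) λ k → ℤ.i≡j⇒i-j≡0 (f≡g _ (y₀+k+1≢y₀ k)))
  where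
  y₀+k+1≢y₀ : ∀ k → y₀ + + suc k ≢ y₀
  y₀+k+1≢y₀ k eq = ℕ.1+n≢0 (ℤ.+-injective (i+j≡i⇒j≡0 eq))

T-not : ∀ {b} → T (not b) ⇔ (¬ T b)
T-not {true}  = mk⇔ (λ ()) (λ ¬t → ¬t _)
T-not {false} = mk⇔ (λ _ ()) (λ _ → _)

T-== : ∀ {k} {a b : Fin k} → T (a == b) ⇔ a ≡ b
T-== {a = a} {b} = mk⇔ (toWitness {a? = a ≟ b}) (fromWitness {a? = a ≟ b})

==-refl : ∀ {k} (a : Fin k) → (a == a) ≡ true
==-refl a = to T-≡ (from T-== refl)

≢⇒==-false : ∀ {k} {a b : Fin k} → a ≢ b → (a == b) ≡ false
≢⇒==-false {a = a} {b} a≢b = to T-not-≡ (from (T-not {a == b}) (a≢b ∘ to T-==))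

T-anyL : ∀ {A : Set} {g : A → Bool} xs → T (anyL g xs) ⇔ Any (T ∘ g) xs
T-anyL []       = mk⇔ (λ ()) (λ ())
T-anyL (x ∷ xs) = mk⇔ (Any.fromSum ∘ Sum.map₂ (to (T-anyL xs)) ∘ to T-∨)
                      (from T-∨ ∘ Sum.map₂ (from (T-anyL xs)) ∘ Any.toSum)

∈-tabulate⁺ : ∀ {n} {p : Fin n → Bool} {v} → T (p v) → v ∈ tabulate p
∈-tabulate⁺ {p = p} {v} t = lookup⇒[]= v _ (trans (lookup∘tabulate p v) (to T-≡ t))

∈-tabulate⁻ : ∀ {n} {p : Fin n → Bool} {v} → v ∈ tabulate p → T (p v)
∈-tabulate⁻ {p = p} {v} v∈ = from T-≡ (trans (sym (lookup∘tabulate p v)) ([]=⇒lookup v∈))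

countL-tabulate : ∀ {n} {A : Set} (p : A → Bool) (f : Fin n → A) →
                  countL p (List.tabulate f) ≡ ∣ tabulate (p ∘ f) ∣
countL-tabulate {zero}  p f = refl
countL-tabulate {suc n} p f with p (f Fin.zero)
... | true  = cong suc (countL-tabulate p (f ∘ Fin.suc))
... | false = countL-tabulate p (f ∘ Fin.suc)

∣p∪q∣≤∣p∣+∣q∣ : ∀ {n} (p q : Subset n) → ∣ p ∪ q ∣ ≤ ∣ p ∣ ℕ.+ ∣ q ∣
∣p∪q∣≤∣p∣+∣q∣ []            []            = z≤n
∣p∪q∣≤∣p∣+∣q∣ (outside ∷ p) (outside ∷ q) = ∣p∪q∣≤∣p∣+∣q∣ p q
∣p∪q∣≤∣p∣+∣q∣ (inside  ∷ p) (s       ∷ q) =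
  ℕ.≤-trans (s≤s (∣p∪q∣≤∣p∣+∣q∣ p q)) (s≤s (ℕ.+-monoʳ-≤ ∣ p ∣ (Subset.∣p∣≤∣x∷p∣ s q)))
∣p∪q∣≤∣p∣+∣q∣ (outside ∷ p) (inside  ∷ q) =
  ℕ.≤-trans (s≤s (∣p∪q∣≤∣p∣+∣q∣ p q)) (ℕ.≤-reflexive (sym (ℕ.+-suc ∣ p ∣ ∣ q ∣)))

∈⇒∣∣-pos : ∀ {n} {p : Subset n} {v} → v ∈ p → 1 ≤ ∣ p ∣
∈⇒∣∣-pos v∈p = ℕ.≤-trans (s≤s z≤n) (Subset.x∈p⇒∣p-x∣<∣p∣ v∈p)

-- Walks, components and rank

module _ {m : ℕ} where

  Adjacent : List (Fin m × Fin m) → Fin m → Fin m → Set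
  Adjacent A a b = (a , b) ∈ₗ A ⊎ (b , a) ∈ₗ A

  infix 4 _⊑_
  _⊑_ : List (Fin m × Fin m) → List (Fin m × Fin m) → Set
  A ⊑ B = ∀ {a b} → Adjacent A a b → Adjacent B a b

  infixl 5 _▷_
  data Walk≤ (A : List (Fin m × Fin m)) : ℕ → Fin m → Fin m → Set where
    ε   : ∀ {k u} → Walk≤ A k u u
    _▷_ : ∀ {k u w v} → Walk≤ A k u w → Adjacent A w v → Walk≤ A (suc k) u v

  private
    variable
      A B : List (Fin m × Fin m)
      a b u v v₁ v₂ w : Fin m
      j k : ℕ

  Adjacent-sym : Adjacent A a b → Adjacent A b a
  Adjacent-sym = Sum.swap

  Walk≤-suc : Walk≤ A k u v → Walk≤ A (suc k) u v
  Walk≤-suc ε       = ε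
  Walk≤-suc (p ▷ e) = Walk≤-suc p ▷ e

  Walk≤-mono : j ≤ k → Walk≤ A j u v → Walk≤ A k u v
  Walk≤-mono j≤k = go (ℕ.≤⇒≤′ j≤k)
    where
    go : ∀ {k} → j ≤′ k → Walk≤ A j u v → Walk≤ A k u v
    go ≤′-refl        p = p
    go (≤′-step j≤′k) p = Walk≤-suc (go j≤′k p)

  infixr 5 _◁_
  _◁_ : Adjacent A u w → Walk≤ A k w v → Walk≤ A (suc k) u v
  e ◁ ε       = ε ▷ e
  e ◁ (p ▷ f) = (e ◁ p) ▷ f

  Walk≤-trans : Walk≤ A j u w → Walk≤ A k w v → Walk≤ A (k ℕ.+ j) u v
  Walk≤-trans {k = k} p ε = Walk≤-mono (ℕ.m≤n+m _ k) p
  Walk≤-trans p (q ▷ e)   = Walk≤-trans p q ▷ e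

  Walk≤-sym : Walk≤ A k u v → Walk≤ A k v u
  Walk≤-sym ε       = ε
  Walk≤-sym (p ▷ e) = Adjacent-sym e ◁ Walk≤-sym p

  Walk≤-⊑ : A ⊑ B → Walk≤ A k u v → Walk≤ B k u v
  Walk≤-⊑ A⊑B ε       = ε
  Walk≤-⊑ A⊑B (p ▷ e) = Walk≤-⊑ A⊑B p ▷ A⊑B e

  reach⇔Walk≤ : ∀ k → T (reach k A u v) ⇔ Walk≤ A k u v
  reach⇔Walk≤ k = mk⇔ (sound k) (complete k)
    where
    sound : ∀ {u v} k → T (reach k A u v) → Walk≤ A k u v
    sound {u = u} {v = v} zero t with to (T-== {a = u} {v}) t
    ... | refl = ε
    sound {A = A} {u = u} {v = v} (suc k) t with to T-∨ t
    ... | inj₁ t′ = Walk≤-suc (sound k t′)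
    ... | inj₂ t′ with find (to (T-anyL A) t′)
    ...   | (a , b) , ab∈A , g with to T-∨ g
    ...     | inj₁ t″ with to T-∧ t″
    ...       | r , v≡b with to (T-== {a = v} {b}) v≡b
    ...         | refl = sound k r ▷ inj₁ ab∈A
    sound {A = A} {u = u} {v = v} (suc k) t | inj₂ t′ | (a , b) , ab∈A , g | inj₂ t″ with to T-∧ t″
    ...       | r , v≡a with to (T-== {a = v} {a}) v≡a
    ...         | refl = sound k r ▷ inj₂ ab∈A
    complete : ∀ {u v} k → Walk≤ A k u v → T (reach k A u v)
    complete zero    ε = from T-== refl
    complete (suc k) ε = from T-∨ (inj₁ (complete k ε))
    complete {A = A} (suc k) (p ▷ inj₁ wv∈A) =
      from T-∨ (inj₂ (from (T-anyL A) (lose wv∈A (from T-∨ (inj₁ (from T-∧ (complete k p , from T-== refl)))))))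
    complete {A = A} (suc k) (p ▷ inj₂ vw∈A) =
      from T-∨ (inj₂ (from (T-anyL A) (lose vw∈A (from T-∨ (inj₂ (from T-∧ (complete k p , from T-== refl)))))))

  Crossing : ℕ → List (Fin m × Fin m) → Fin m → Fin m → Fin m → Fin m → Set
  Crossing k A a b u v = Walk≤ A k u a × Walk≤ A k b v

  Split : ℕ → List (Fin m × Fin m) → Fin m → Fin m → Fin m → Fin m → Set
  Split k A a b u v = Walk≤ A k u v ⊎ Crossing k A a b u v ⊎ Crossing k A b a u v

  Split-swap : Split k A a b u v → Split k A b a u v
  Split-swap = Sum.map₂ Sum.swap

  Split-extend : Adjacent A w v → Split k A a b u w → Split (suc k) A a b u v
  Split-extend e = Sum.map (_▷ e) (Sum.map (Prod.map Walk≤-suc (_▷ e)) (Prod.map Walk≤-suc (_▷ e)))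

  Split-cross : Split k A a b u a → Split (suc k) A a b u b
  Split-cross (inj₁ p)               = inj₂ (inj₁ (Walk≤-suc p , ε))
  Split-cross (inj₂ (inj₁ (p , _)))  = inj₂ (inj₁ (Walk≤-suc p , ε))
  Split-cross (inj₂ (inj₂ (p , _)))  = inj₁ (Walk≤-suc p)

  Walk≤-∷⁻ : Walk≤ ((a , b) ∷ A) k u v → Split k A a b u v
  Walk≤-∷⁻ ε                      = inj₁ ε
  Walk≤-∷⁻ (p ▷ inj₁ (here refl)) = Split-cross (Walk≤-∷⁻ p)
  Walk≤-∷⁻ (p ▷ inj₂ (here refl)) = Split-swap (Split-cross (Split-swap (Walk≤-∷⁻ p)))
  Walk≤-∷⁻ (p ▷ inj₁ (there e))   = Split-extend (inj₁ e) (Walk≤-∷⁻ p)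
  Walk≤-∷⁻ (p ▷ inj₂ (there e))   = Split-extend (inj₂ e) (Walk≤-∷⁻ p)

  module _ (A : List (Fin m × Fin m)) (u : Fin m) where

    reachable : ℕ → Subset m
    reachable k = tabulate (reach k A u)

    ∈-reachable : ∀ k → v ∈ reachable k ⇔ Walk≤ A k u v
    ∈-reachable k = mk⇔ (to (reach⇔Walk≤ k) ∘ ∈-tabulate⁻) (∈-tabulate⁺ ∘ from (reach⇔Walk≤ k))

    Stable : ℕ → Set
    Stable k = ∀ {v} → Walk≤ A (suc k) u v → Walk≤ A k u v

    Stable⇒Walk≤ : Stable j → Walk≤ A k u v → Walk≤ A j u v
    Stable⇒Walk≤ st ε       = ε
    Stable⇒Walk≤ st (p ▷ e) = st (Stable⇒Walk≤ st p ▷ e)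

    stabilises : ∀ k → (∃ λ j → j ≤ k × Stable j) ⊎ k < ∣ reachable k ∣
    stabilises zero = inj₂ (∈⇒∣∣-pos (from (∈-reachable 0) ε))
    stabilises (suc k) with stabilises k
    ... | inj₁ (j , j≤k , st) = inj₁ (j , ℕ.m≤n⇒m≤1+n j≤k , st)
    ... | inj₂ k<∣Rₖ∣ with reachable k ⊂? reachable (suc k)
    ...   | yes Rₖ⊂Rₖ₊₁ = inj₂ (ℕ.≤-trans (s≤s k<∣Rₖ∣) (Subset.p⊂q⇒∣p∣<∣q∣ Rₖ⊂Rₖ₊₁))
    ...   | no  Rₖ⊄Rₖ₊₁ = inj₁ (k , ℕ.n≤1+n k , stable)
      where
      Rₖ⊆Rₖ₊₁ : reachable k ⊆ reachable (suc k)
      Rₖ⊆Rₖ₊₁ v∈Rₖ = from (∈-reachable (suc k)) (Walk≤-suc (to (∈-reachable k) v∈Rₖ))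
      stable : Stable k
      stable {v} p with v Subset.∈? reachable k
      ... | yes v∈Rₖ = to (∈-reachable k) v∈Rₖ
      ... | no  v∉Rₖ =
        contradiction ((λ {x} → Rₖ⊆Rₖ₊₁ {x}) , v , from (∈-reachable (suc k)) p , v∉Rₖ) Rₖ⊄Rₖ₊₁

  Walk≤-shorten : Walk≤ A k u v → Walk≤ A m u v
  Walk≤-shorten {A = A} {u = u} p with stabilises A u m
  ... | inj₁ (j , j≤m , st) = Walk≤-mono j≤m (Stable⇒Walk≤ A u st p)
  ... | inj₂ m<∣R∣          = contradiction (Subset.∣p∣≤n (reachable A u m)) (ℕ.<⇒≱ m<∣R∣)

  sameComp⇔Walk≤ : T (sameComp A u v) ⇔ Walk≤ A m u v
  sameComp⇔Walk≤ = reach⇔Walk≤ m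

  Walk≤ᵐ-trans : Walk≤ A m u w → Walk≤ A m w v → Walk≤ A m u v
  Walk≤ᵐ-trans p q = Walk≤-shorten (Walk≤-trans p q)

  Walk≤-[] : Walk≤ [] k u v → u ≡ v
  Walk≤-[] ε                 = refl
  Walk≤-[] (_ ▷ inj₁ ())
  Walk≤-[] (_ ▷ inj₂ ())

  joinsSmaller : List (Fin m × Fin m) → Fin m → Fin m → Bool
  joinsSmaller A v u = ⌊ u <? v ⌋ ∧ sameComp A u v

  leader : List (Fin m × Fin m) → Fin m → Bool
  leader A v = not (anyL (joinsSmaller A v) (allFin m))

  leaders : List (Fin m × Fin m) → Subset m
  leaders A = tabulate (leader A)

  comps≡∣leaders∣ : ∀ A → comps m A ≡ ∣ leaders A ∣
  comps≡∣leaders∣ A = countL-tabulate (leader A) id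

  T-joinsSmaller : T (joinsSmaller A v u) ⇔ (u Fin.< v × Walk≤ A m u v)
  T-joinsSmaller {A} {v} {u} = mk⇔
    (Prod.map toWitness (to sameComp⇔Walk≤) ∘ to (T-∧ {⌊ u <? v ⌋} {sameComp A u v}))
    (from (T-∧ {⌊ u <? v ⌋} {sameComp A u v}) ∘ Prod.map fromWitness (from sameComp⇔Walk≤))

  T-anyL-joinsSmaller : T (anyL (joinsSmaller A v) (allFin m)) ⇔ (∃ λ u → u Fin.< v × Walk≤ A m u v)
  T-anyL-joinsSmaller {A} {v} = mk⇔
    (λ t → let u , _ , j = find (to (T-anyL {g = joinsSmaller A v} (allFin m)) t) in u , to T-joinsSmaller j)
    (λ (u , j) → from (T-anyL {g = joinsSmaller A v} (allFin m)) (lose (∈-allFin u) (from T-joinsSmaller j)))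

  ∈-leaders : v ∈ leaders A ⇔ (∀ {u} → u Fin.< v → ¬ Walk≤ A m u v)
  ∈-leaders {v} {A} = mk⇔ ⇒ ⇐
    where
    T-not′ = T-not {anyL (joinsSmaller A v) (allFin m)}
    ⇒ : v ∈ leaders A → ∀ {u} → u Fin.< v → ¬ Walk≤ A m u v
    ⇒ v∈ u<v p = to T-not′ (∈-tabulate⁻ v∈) (from T-anyL-joinsSmaller (_ , u<v , p))
    ⇐ : (∀ {u} → u Fin.< v → ¬ Walk≤ A m u v) → v ∈ leaders A
    ⇐ least = ∈-tabulate⁺ (from T-not′ λ t → let _ , u<v , p = to T-anyL-joinsSmaller t in least u<v p)

  ∉-leaders : v ∉ leaders A → ∃ λ u → u Fin.< v × Walk≤ A m u v
  ∉-leaders {v} {A} v∉ with T? (anyL (joinsSmaller A v) (allFin m))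
  ... | yes t = to T-anyL-joinsSmaller t
  ... | no ¬t = contradiction (∈-tabulate⁺ (from (T-not {anyL (joinsSmaller A v) (allFin m)}) ¬t)) v∉

  leaders-antitone : A ⊑ B → leaders B ⊆ leaders A
  leaders-antitone A⊑B v∈ = from ∈-leaders λ u<v p → to ∈-leaders v∈ u<v (Walk≤-⊑ A⊑B p)

  comps-antitone : A ⊑ B → comps m B ≤ comps m A
  comps-antitone {A} {B} A⊑B = subst₂ _≤_ (sym (comps≡∣leaders∣ B)) (sym (comps≡∣leaders∣ A))
    (Subset.p⊆q⇒∣p∣≤∣q∣ (leaders-antitone A⊑B))

  m≤comps-[] : m ≤ comps m []
  m≤comps-[] = subst₂ _≤_ (Subset.∣⊤∣≡n m) (sym (comps≡∣leaders∣ []))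
    (Subset.p⊆q⇒∣p∣≤∣q∣ {p = ⊤} {q = leaders []} λ _ →
       from ∈-leaders λ u<v p → Fin.<-irrefl (Walk≤-[] p) u<v)

  LostLeader : List (Fin m × Fin m) → Fin m → Fin m → Fin m → Set
  LostLeader A a b v = ∃ λ u → u Fin.< v × (Crossing m A a b u v ⊎ Crossing m A b a u v)

  lost-leader : v ∈ leaders A → v ∉ leaders ((a , b) ∷ A) → LostLeader A a b v
  lost-leader v∈ v∉ with ∉-leaders v∉
  ... | u , u<v , p with Walk≤-∷⁻ p
  ...   | inj₁ q        = contradiction q (to ∈-leaders v∈ u<v)
  ...   | inj₂ crossing = u , u<v , crossing

  -- two lost leaders v₁ < v₂ would put v₂ in the component of a smaller vertex
  lost-leader-unique< : v₁ Fin.< v₂ → v₂ ∈ leaders A → LostLeader A a b v₁ → LostLeader A a b v₂ → ⊥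
  lost-leader-unique< v₁<v₂ v₂∈ (_ , _ , inj₁ (_ , bv₁)) (_ , _ , inj₁ (_ , bv₂)) =
    to ∈-leaders v₂∈ v₁<v₂ (Walk≤ᵐ-trans (Walk≤-sym bv₁) bv₂)
  lost-leader-unique< v₁<v₂ v₂∈ (_ , u₁<v₁ , inj₁ (u₁a , _)) (_ , _ , inj₂ (_ , av₂)) =
    to ∈-leaders v₂∈ (Fin.<-trans u₁<v₁ v₁<v₂) (Walk≤ᵐ-trans u₁a av₂)
  lost-leader-unique< v₁<v₂ v₂∈ (_ , u₁<v₁ , inj₂ (u₁b , _)) (_ , _ , inj₁ (_ , bv₂)) =
    to ∈-leaders v₂∈ (Fin.<-trans u₁<v₁ v₁<v₂) (Walk≤ᵐ-trans u₁b bv₂)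
  lost-leader-unique< v₁<v₂ v₂∈ (_ , _ , inj₂ (_ , av₁)) (_ , _ , inj₂ (_ , av₂)) =
    to ∈-leaders v₂∈ v₁<v₂ (Walk≤ᵐ-trans (Walk≤-sym av₁) av₂)

  lost-leader-unique : v₁ ∈ leaders A → LostLeader A a b v₁ →
                       v₂ ∈ leaders A → LostLeader A a b v₂ → v₁ ≡ v₂
  lost-leader-unique {v₁ = v₁} {v₂ = v₂} v₁∈ l₁ v₂∈ l₂ with Fin.<-cmp v₁ v₂
  ... | tri< v₁<v₂ _ _ = contradiction l₂ (lost-leader-unique< v₁<v₂ v₂∈ l₁)
  ... | tri≈ _ v₁≡v₂ _ = v₁≡v₂
  ... | tri> _ _ v₂<v₁ = contradiction l₁ (lost-leader-unique< v₂<v₁ v₁∈ l₂)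

  comps-∷ : comps m A ≤ suc (comps m ((a , b) ∷ A))
  comps-∷ {A} {a} {b} =
    subst₂ _≤_ (sym (comps≡∣leaders∣ A)) (cong suc (sym (comps≡∣leaders∣ ((a , b) ∷ A)))) ∣R∣≤1+∣R′∣
    where
    R R′ : Subset m
    R  = leaders A
    R′ = leaders ((a , b) ∷ A)
    ∣R∣≤1+∣R′∣ : ∣ R ∣ ≤ suc ∣ R′ ∣
    ∣R∣≤1+∣R′∣ with Fin.any? (λ v → v Subset.∈? R ×-dec ¬? (v Subset.∈? R′))
    ... | yes (v , v∈R , v∉R′) = begin
      ∣ R ∣               ≤⟨ Subset.p⊆q⇒∣p∣≤∣q∣ R⊆R′∪⁅v⁆ ⟩
      ∣ R′ ∪ ⁅ v ⁆ ∣      ≤⟨ ∣p∪q∣≤∣p∣+∣q∣ R′ ⁅ v ⁆ ⟩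
      ∣ R′ ∣ ℕ.+ ∣ ⁅ v ⁆ ∣ ≡⟨ cong (∣ R′ ∣ ℕ.+_) (Subset.∣⁅x⁆∣≡1 v) ⟩
      ∣ R′ ∣ ℕ.+ 1        ≡⟨ ℕ.+-comm ∣ R′ ∣ 1 ⟩
      suc ∣ R′ ∣          ∎
      where
      open ℕ.≤-Reasoning
      R⊆R′∪⁅v⁆ : R ⊆ R′ ∪ ⁅ v ⁆
      R⊆R′∪⁅v⁆ {w} w∈R with w Subset.∈? R′
      ... | yes w∈R′ = Subset.x∈p∪q⁺ (inj₁ w∈R′)
      ... | no  w∉R′ = Subset.x∈p∪q⁺ {p = R′} (inj₂ (subst (_∈ ⁅ v ⁆)
            (lost-leader-unique v∈R (lost-leader v∈R v∉R′) w∈R (lost-leader w∈R w∉R′)) (Subset.x∈⁅x⁆ v)))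
    ... | no ∄ = ℕ.m≤n⇒m≤1+n (Subset.p⊆q⇒∣p∣≤∣q∣ R⊆R′)
      where
      R⊆R′ : R ⊆ R′
      R⊆R′ {w} w∈R with w Subset.∈? R′
      ... | yes w∈R′ = w∈R′
      ... | no  w∉R′ = contradiction (w , w∈R , w∉R′) ∄

  rank-∷ : ∀ x A → rank m (x ∷ A) ≤ suc (rank m A)
  rank-∷ (a , b) A = ℕ.m≤n+o⇒m∸n≤o m (comps m ((a , b) ∷ A)) (begin
    m                                        ≤⟨ ℕ.m≤n+m∸n m (comps m A) ⟩
    comps m A ℕ.+ rank m A                   ≤⟨ ℕ.+-monoˡ-≤ (rank m A) comps-∷ ⟩
    suc (comps m ((a , b) ∷ A)) ℕ.+ rank m A ≡⟨ ℕ.+-suc (comps m ((a , b) ∷ A)) (rank m A) ⟨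
    comps m ((a , b) ∷ A) ℕ.+ suc (rank m A) ∎)
    where open ℕ.≤-Reasoning

  rank≤length : ∀ A → rank m A ≤ List.length A
  rank≤length []      = ℕ.≤-reflexive (ℕ.m≤n⇒m∸n≡0 m≤comps-[])
  rank≤length (x ∷ A) = ℕ.≤-trans (rank-∷ x A) (s≤s (rank≤length A))

  rank-cong : A ⊑ B → B ⊑ A → rank m A ≡ rank m B
  rank-cong A⊑B B⊑A = cong (m ∸_) (ℕ.≤-antisym (comps-antitone B⊑A) (comps-antitone A⊑B))

  ⊑-∷ : ∀ {x} → A ⊑ x ∷ A
  ⊑-∷ = Sum.map there there

  ↭⇒⊑ : A ↭ B → A ⊑ B
  ↭⇒⊑ A↭B = Sum.map (∈-resp-↭ A↭B) (∈-resp-↭ A↭B)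

  rank-↭ : A ↭ B → rank m A ≡ rank m B
  rank-↭ A↭B = rank-cong (↭⇒⊑ A↭B) (↭⇒⊑ (↭-sym A↭B))

  ∷-dup-⊑ : ∀ {x} → x ∷ x ∷ A ⊑ x ∷ A
  ∷-dup-⊑ = Sum.map dedup dedup
    where
    dedup : ∀ {x y} → y ∈ₗ x ∷ x ∷ A → y ∈ₗ x ∷ A
    dedup (here y≡x) = here y≡x
    dedup (there y∈) = y∈

  infix 4 _∥_
  _∥_ : Fin m × Fin m → Fin m × Fin m → Set
  x ∥ y = y ≡ x ⊎ y ≡ Prod.swap x

  ∥-sym : ∀ {x y} → x ∥ y → y ∥ x
  ∥-sym {a , b} (inj₁ refl) = inj₁ refl
  ∥-sym {a , b} (inj₂ refl) = inj₂ refl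

  ∥⇒∷-⊑ : ∀ {x y} → x ∥ y → x ∷ A ⊑ y ∷ A
  ∥⇒∷-⊑ (inj₁ refl) e = e
  ∥⇒∷-⊑ (inj₂ refl) (inj₁ (here refl)) = inj₂ (here refl)
  ∥⇒∷-⊑ (inj₂ refl) (inj₂ (here refl)) = inj₁ (here refl)
  ∥⇒∷-⊑ (inj₂ refl) (inj₁ (there e))   = inj₁ (there e)
  ∥⇒∷-⊑ (inj₂ refl) (inj₂ (there e))   = inj₂ (there e)

comps-∷-connected : ∀ {m x} {A : List (Fin m × Fin m)} → comps m A ≡ 1 → comps m (x ∷ A) ≡ 1
comps-∷-connected {zero}      ()
comps-∷-connected {suc m} {x} {A} c≡1 = ℕ.≤-antisym comps≤1 1≤comps
  where
  comps≤1 : comps (suc m) (x ∷ A) ≤ 1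
  comps≤1 = subst (comps (suc m) (x ∷ A) ≤_) c≡1 (comps-antitone {A = A} {B = x ∷ A} ⊑-∷)
  zero∈leaders : Fin.zero ∈ leaders (x ∷ A)
  zero∈leaders = from ∈-leaders λ ()
  1≤comps : 1 ≤ comps (suc m) (x ∷ A)
  1≤comps = subst (1 ≤_) (sym (comps≡∣leaders∣ (x ∷ A))) (∈⇒∣∣-pos zero∈leaders)

-- Sums over sublists

module _ {A : Set} where
  private
    variable
      φ ψ : List A → ℤ
      L L′ : List A

  sumℤ-++ : ∀ (is js : List ℤ) → sumℤ (is ++ js) ≡ sumℤ is + sumℤ js
  sumℤ-++ []       js = sym (ℤ.+-identityˡ (sumℤ js))
  sumℤ-++ (i ∷ is) js = trans (cong (_+_ i) (sumℤ-++ is js)) (sym (ℤ.+-assoc i (sumℤ is) (sumℤ js)))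

  sumℤ-*ˡ : ∀ c (is : List ℤ) → sumℤ (map (c *_) is) ≡ c * sumℤ is
  sumℤ-*ˡ c []       = sym (ℤ.*-zeroʳ c)
  sumℤ-*ˡ c (i ∷ is) = trans (cong (_+_ (c * i)) (sumℤ-*ˡ c is)) (sym (ℤ.*-distribˡ-+ c i (sumℤ is)))

  Σ⊆ : (List A → ℤ) → List A → ℤ
  Σ⊆ φ L = sumℤ (map φ (subsets L))

  Σ⊆-∷ : ∀ φ x L → Σ⊆ φ (x ∷ L) ≡ Σ⊆ (φ ∘ (x ∷_)) L + Σ⊆ φ L
  Σ⊆-∷ φ x L = begin
    sumℤ (map φ (map (x ∷_) (subsets L) ++ subsets L))
      ≡⟨ cong sumℤ (List.map-++ φ (map (x ∷_) (subsets L)) (subsets L)) ⟩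
    sumℤ (map φ (map (x ∷_) (subsets L)) ++ map φ (subsets L))
      ≡⟨ sumℤ-++ (map φ (map (x ∷_) (subsets L))) (map φ (subsets L)) ⟩
    sumℤ (map φ (map (x ∷_) (subsets L))) + Σ⊆ φ L
      ≡⟨ cong (λ is → sumℤ is + Σ⊆ φ L) (List.map-∘ (subsets L)) ⟨
    Σ⊆ (φ ∘ (x ∷_)) L + Σ⊆ φ L ∎
    where open ≡-Reasoning

  Σ⊆-cong : ∀ L → (∀ B → φ B ≡ ψ B) → Σ⊆ φ L ≡ Σ⊆ ψ L
  Σ⊆-cong L φ≗ψ = cong sumℤ (List.map-cong φ≗ψ (subsets L))

  Σ⊆-*ˡ : ∀ c φ L → Σ⊆ (λ B → c * φ B) L ≡ c * Σ⊆ φ L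
  Σ⊆-*ˡ c φ L = trans (cong sumℤ (List.map-∘ (subsets L))) (sumℤ-*ˡ c (map φ (subsets L)))

  Σ⊆-↭ : (∀ {B C} → B ↭ C → φ B ≡ φ C) → L ↭ L′ → Σ⊆ φ L ≡ Σ⊆ φ L′
  Σ⊆-↭ inv ↭.refl = refl
  Σ⊆-↭ {φ = φ} {L = _ ∷ L} {L′ = _ ∷ L′} inv (prep x p) = begin
    Σ⊆ φ (x ∷ L)                 ≡⟨ Σ⊆-∷ φ x L ⟩
    Σ⊆ (φ ∘ (x ∷_)) L + Σ⊆ φ L   ≡⟨ cong₂ _+_ (Σ⊆-↭ (inv ∘ prep x) p) (Σ⊆-↭ inv p) ⟩
    Σ⊆ (φ ∘ (x ∷_)) L′ + Σ⊆ φ L′ ≡⟨ Σ⊆-∷ φ x L′ ⟨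
    Σ⊆ φ (x ∷ L′)                ∎
    where open ≡-Reasoning
  Σ⊆-↭ {φ = φ} {L = _ ∷ _ ∷ L} {L′ = _ ∷ _ ∷ L′} inv (swap x y p) = begin
    Σ⊆ φ (x ∷ y ∷ L)
      ≡⟨ expand x y L ⟩
    (Σ⊆ (φ ∘ (x ∷_) ∘ (y ∷_)) L + Σ⊆ (φ ∘ (x ∷_)) L) + (Σ⊆ (φ ∘ (y ∷_)) L + Σ⊆ φ L)
      ≡⟨ cong₂ _+_ (cong₂ _+_ xy≡yx (Σ⊆-↭ (inv ∘ prep x) p))
                   (cong₂ _+_ (Σ⊆-↭ (inv ∘ prep y) p) (Σ⊆-↭ inv p)) ⟩
    (Σ⊆ (φ ∘ (y ∷_) ∘ (x ∷_)) L′ + Σ⊆ (φ ∘ (x ∷_)) L′) + (Σ⊆ (φ ∘ (y ∷_)) L′ + Σ⊆ φ L′)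
      ≡⟨ interchange (Σ⊆ (φ ∘ (y ∷_) ∘ (x ∷_)) L′) (Σ⊆ (φ ∘ (x ∷_)) L′)
                     (Σ⊆ (φ ∘ (y ∷_)) L′) (Σ⊆ φ L′) ⟩
    (Σ⊆ (φ ∘ (y ∷_) ∘ (x ∷_)) L′ + Σ⊆ (φ ∘ (y ∷_)) L′) + (Σ⊆ (φ ∘ (x ∷_)) L′ + Σ⊆ φ L′)
      ≡⟨ expand y x L′ ⟨
    Σ⊆ φ (y ∷ x ∷ L′) ∎
    where
    open ≡-Reasoning
    expand : ∀ x y L → Σ⊆ φ (x ∷ y ∷ L) ≡
      (Σ⊆ (φ ∘ (x ∷_) ∘ (y ∷_)) L + Σ⊆ (φ ∘ (x ∷_)) L) + (Σ⊆ (φ ∘ (y ∷_)) L + Σ⊆ φ L)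
    expand x y L = trans (Σ⊆-∷ φ x (y ∷ L)) (cong₂ _+_ (Σ⊆-∷ (φ ∘ (x ∷_)) y L) (Σ⊆-∷ φ y L))
    xy≡yx : Σ⊆ (φ ∘ (x ∷_) ∘ (y ∷_)) L ≡ Σ⊆ (φ ∘ (y ∷_) ∘ (x ∷_)) L′
    xy≡yx = trans (Σ⊆-↭ (inv ∘ prep x ∘ prep y) p) (Σ⊆-cong L′ (λ B → inv (swap x y (↭-refl {x = B}))))
  Σ⊆-↭ inv (↭.trans p q) = trans (Σ⊆-↭ inv p) (Σ⊆-↭ inv q)

-- The recurrence for a pair of parallel edges

keepIdx-cong : ∀ {A : Set} (xs : List A) {p q : Fin (length xs) → Bool} →
               (∀ i → p i ≡ q i) → keepIdx xs p ≡ keepIdx xs q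
keepIdx-cong []       p≗q = refl
keepIdx-cong (x ∷ xs) p≗q rewrite p≗q Fin.zero | keepIdx-cong xs (p≗q ∘ Fin.suc) = refl

keepIdx-all : ∀ {A : Set} (xs : List A) → keepIdx xs (λ _ → true) ≡ xs
keepIdx-all []       = refl
keepIdx-all (x ∷ xs) = cong (x ∷_) (keepIdx-all xs)

keepIdx-remove : ∀ {A : Set} (xs : List A) {p q : Fin (length xs) → Bool} i →
                 p i ≡ true → q i ≡ false → (∀ j → j ≢ i → p j ≡ q j) →
                 keepIdx xs p ↭ lookup xs i ∷ keepIdx xs q
keepIdx-remove (x ∷ xs) Fin.zero pi qi p≈q rewrite pi | qi =
  ↭-reflexive (cong (x ∷_) (keepIdx-cong xs λ j → p≈q (Fin.suc j) λ ()))
keepIdx-remove (x ∷ xs) {p} {q} (Fin.suc i) pi qi p≈q rewrite p≈q Fin.zero (λ ()) with q Fin.zero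
... | true  = ↭-trans (prep x (keepIdx-remove xs i pi qi p≈q′)) (swap x (lookup xs i) ↭-refl)
  where
  p≈q′ : ∀ j → j ≢ i → p (Fin.suc j) ≡ q (Fin.suc j)
  p≈q′ j j≢i = p≈q (Fin.suc j) (j≢i ∘ Fin.suc-injective)
... | false = keepIdx-remove xs i pi qi λ j j≢i → p≈q (Fin.suc j) (j≢i ∘ Fin.suc-injective)

parallelRHS : ℤ → ℤ → ℤ → ℤ
parallelRHS y t₁ t₂ = (1ℤ + y) * t₁ - y * t₂

parallelRHS-injectiveˡ : ∀ {y t₁ t₁′ t₂} → y ≢ -1ℤ →
                         parallelRHS y t₁ t₂ ≡ parallelRHS y t₁′ t₂ → t₁ ≡ t₁′
parallelRHS-injectiveˡ {y} {t₁} {t₁′} {t₂} y≢-1 eq =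
  ℤ.*-cancelˡ-≡ (1ℤ + y) t₁ t₁′ {{≢-nonZero 1+y≢0}} (begin
    (1ℤ + y) * t₁                 ≡⟨ add-back ((1ℤ + y) * t₁) (y * t₂) ⟩
    parallelRHS y t₁ t₂ + y * t₂  ≡⟨ cong (_+ y * t₂) eq ⟩
    parallelRHS y t₁′ t₂ + y * t₂ ≡⟨ add-back ((1ℤ + y) * t₁′) (y * t₂) ⟨
    (1ℤ + y) * t₁′                ∎)
  where
  open ≡-Reasoning
  add-back : ∀ a b → a ≡ (a - b) + b
  add-back = solve-∀
  1+y-1≡y : ∀ y → (1ℤ + y) - 1ℤ ≡ y
  1+y-1≡y = solve-∀
  1+y≢0 : 1ℤ + y ≢ 0ℤ
  1+y≢0 1+y≡0 = y≢-1 (trans (sym (1+y-1≡y y)) (cong (_- 1ℤ) 1+y≡0))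

parallelRHS-injectiveʳ : ∀ {y t₁ t₂ t₂′} → y ≢ 0ℤ →
                         parallelRHS y t₁ t₂ ≡ parallelRHS y t₁ t₂′ → t₂ ≡ t₂′
parallelRHS-injectiveʳ {y} {t₁} {t₂} {t₂′} y≢0 eq =
  ℤ.*-cancelˡ-≡ y t₂ t₂′ {{≢-nonZero y≢0}} (begin
    y * t₂                               ≡⟨ subtract-twice ((1ℤ + y) * t₁) (y * t₂) ⟩
    (1ℤ + y) * t₁ - parallelRHS y t₁ t₂  ≡⟨ cong (_-_ ((1ℤ + y) * t₁)) eq ⟩
    (1ℤ + y) * t₁ - parallelRHS y t₁ t₂′ ≡⟨ subtract-twice ((1ℤ + y) * t₁) (y * t₂′) ⟨
    y * t₂′                              ∎)
  where
  open ≡-Reasoning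
  subtract-twice : ∀ a b → b ≡ a - (a - b)
  subtract-twice = solve-∀

module _ {m : ℕ} (x y : ℤ) where
  private
    variable
      L L′ : List (Fin m × Fin m)

  tutteTerm : ℕ → List (Fin m × Fin m) → ℤ
  tutteTerm R B = (x - 1ℤ) ^ (R ∸ rank m B) * (y - 1ℤ) ^ (length B ∸ rank m B)

  -- tutteΣ x y (edges G) unfolds to tutte G x y
  tutteΣ : List (Fin m × Fin m) → ℤ
  tutteΣ L = Σ⊆ (tutteTerm (rank m L)) L

  tutteTerm-↭ : ∀ R {B C} → B ↭ C → tutteTerm R B ≡ tutteTerm R C
  tutteTerm-↭ R B↭C rewrite rank-↭ B↭C | ↭-length B↭C = refl

  tutteΣ-↭ : L ↭ L′ → tutteΣ L ≡ tutteΣ L′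
  tutteΣ-↭ {L} {L′} L↭L′ = begin
    Σ⊆ (tutteTerm (rank m L)) L   ≡⟨ cong (λ R → Σ⊆ (tutteTerm R) L) (rank-↭ L↭L′) ⟩
    Σ⊆ (tutteTerm (rank m L′)) L  ≡⟨ Σ⊆-↭ (tutteTerm-↭ (rank m L′)) L↭L′ ⟩
    Σ⊆ (tutteTerm (rank m L′)) L′ ∎
    where open ≡-Reasoning

  -- Every rank below equals rank L, and adding x₁ to a set containing x₂ keeps its rank.
  tutteΣ-parallel : ∀ {x₁ x₂} L → x₁ ∥ x₂ → comps m L ≡ 1 →
                    tutteΣ (x₁ ∷ x₂ ∷ L) ≡ parallelRHS y (tutteΣ (x₂ ∷ L)) (tutteΣ L)
  tutteΣ-parallel {x₁} {x₂} L x₁∥x₂ connected = begin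
    Σ⊆ (tutteTerm (rank m (x₁ ∷ x₂ ∷ L))) (x₁ ∷ x₂ ∷ L)
      ≡⟨ cong (λ R → Σ⊆ (tutteTerm R) (x₁ ∷ x₂ ∷ L)) (trans (rank-x₁x₂ L) rank-x₂) ⟩
    Σ⊆ t (x₁ ∷ x₂ ∷ L)
      ≡⟨ trans (Σ⊆-∷ t x₁ (x₂ ∷ L)) (cong₂ _+_ (Σ⊆-∷ (t ∘ (x₁ ∷_)) x₂ L) (Σ⊆-∷ t x₂ L)) ⟩
    (Σ⊆ (t ∘ (x₁ ∷_) ∘ (x₂ ∷_)) L + Σ⊆ (t ∘ (x₁ ∷_)) L) + (u + a)
      ≡⟨ cong (_+ (u + a)) (cong₂ _+_ (trans (Σ⊆-cong L term-x₁x₂) (Σ⊆-*ˡ (y - 1ℤ) (t ∘ (x₂ ∷_)) L))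
                                      (Σ⊆-cong L term-x₁)) ⟩
    ((y - 1ℤ) * u + u) + (u + a)
      ≡⟨ lemma y u a ⟩
    (1ℤ + y) * (u + a) - y * a
      ≡⟨ cong (λ s → (1ℤ + y) * s - y * a) (Σ⊆-∷ t x₂ L) ⟨
    (1ℤ + y) * Σ⊆ t (x₂ ∷ L) - y * a
      ≡⟨ cong (λ R → (1ℤ + y) * Σ⊆ (tutteTerm R) (x₂ ∷ L) - y * a) rank-x₂ ⟨
    parallelRHS y (tutteΣ (x₂ ∷ L)) (tutteΣ L) ∎
    where
    open ≡-Reasoning
    R = rank m L
    t = tutteTerm R
    u = Σ⊆ (t ∘ (x₂ ∷_)) L
    a = Σ⊆ t L
    rank-x₂ : rank m (x₂ ∷ L) ≡ R
    rank-x₂ = cong (m ∸_) (trans (comps-∷-connected {x = x₂} {A = L} connected) (sym connected))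
    rank-x₁ : ∀ B → rank m (x₁ ∷ B) ≡ rank m (x₂ ∷ B)
    rank-x₁ B = rank-cong (∥⇒∷-⊑ x₁∥x₂) (∥⇒∷-⊑ (∥-sym x₁∥x₂))
    rank-x₁x₂ : ∀ B → rank m (x₁ ∷ x₂ ∷ B) ≡ rank m (x₂ ∷ B)
    rank-x₁x₂ B = rank-cong (∷-dup-⊑ ∘ ∥⇒∷-⊑ x₁∥x₂) ⊑-∷
    term-x₁ : ∀ B → t (x₁ ∷ B) ≡ t (x₂ ∷ B)
    term-x₁ B rewrite rank-x₁ B = refl
    term-x₁x₂ : ∀ B → t (x₁ ∷ x₂ ∷ B) ≡ (y - 1ℤ) * t (x₂ ∷ B)
    term-x₁x₂ B rewrite rank-x₁x₂ B | ℕ.+-∸-assoc 1 (rank≤length {m} (x₂ ∷ B)) =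
      swap-* ((x - 1ℤ) ^ (R ∸ rank m (x₂ ∷ B))) (y - 1ℤ) ((y - 1ℤ) ^ (suc (length B) ∸ rank m (x₂ ∷ B)))
      where
      swap-* : ∀ c z w → c * (z * w) ≡ z * (c * w)
      swap-* = solve-∀
    lemma : ∀ y u a → ((y - 1ℤ) * u + u) + (u + a) ≡ (1ℤ + y) * (u + a) - y * a
    lemma = solve-∀

edges-delete1 : ∀ G e → edges G ↭ ends G e ∷ edges (delete1 G e)
edges-delete1 G e = ↭-trans (↭-reflexive (sym (keepIdx-all (edges G))))
  (keepIdx-remove (edges G) e refl (cong not (==-refl e)) λ j j≢e → cong not (sym (≢⇒==-false j≢e)))

edges-delete2 : ∀ G e₁ e₂ → e₁ ≢ e₂ → edges (delete1 G e₁) ↭ ends G e₂ ∷ edges (delete2 G e₁ e₂)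
edges-delete2 G e₁ e₂ e₁≢e₂ = keepIdx-remove (edges G) e₂
  (cong not (≢⇒==-false (e₁≢e₂ ∘ sym)))
  (trans (cong (λ b → not ((e₂ == e₁) ∨ b)) (==-refl e₂)) (cong not (∨-zeroʳ (e₂ == e₁))))
  λ j j≢e₂ → cong not (sym (trans (cong ((j == e₁) ∨_) (≢⇒==-false j≢e₂)) (∨-identityʳ (j == e₁))))

Parallel⇒∥ : ∀ G {e₁ e₂} → Parallel G e₁ e₂ → ends G e₁ ∥ ends G e₂
Parallel⇒∥ G (inj₁ (p , q)) = inj₁ (cong₂ _,_ (sym p) (sym q))
Parallel⇒∥ G (inj₂ (p , q)) = inj₂ (cong₂ _,_ (sym q) (sym p))

tutte-parallel : ∀ G e₁ e₂ → e₁ ≢ e₂ → Parallel G e₁ e₂ → Connected (delete2 G e₁ e₂) → ∀ x y →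
                 tutte G x y ≡ parallelRHS y (tutte (delete1 G e₁) x y) (tutte (delete2 G e₁ e₂) x y)
tutte-parallel G e₁ e₂ e₁≢e₂ e₁∥e₂ connected x y = begin
  tutteΣ x y (edges G)
    ≡⟨ tutteΣ-↭ x y (↭-trans (edges-delete1 G e₁) (prep _ (edges-delete2 G e₁ e₂ e₁≢e₂))) ⟩
  tutteΣ x y (ends G e₁ ∷ ends G e₂ ∷ edges (delete2 G e₁ e₂))
    ≡⟨ tutteΣ-parallel x y (edges (delete2 G e₁ e₂)) (Parallel⇒∥ G e₁∥e₂) connected ⟩
  parallelRHS y (tutteΣ x y (ends G e₂ ∷ edges (delete2 G e₁ e₂))) (tutte (delete2 G e₁ e₂) x y)
    ≡⟨ cong (λ t → parallelRHS y t (tutte (delete2 G e₁ e₂) x y))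
            (tutteΣ-↭ x y (↭-sym (edges-delete2 G e₁ e₂ e₁≢e₂))) ⟩
  parallelRHS y (tutte (delete1 G e₁) x y) (tutte (delete2 G e₁ e₂) x y) ∎
  where open ≡-Reasoning

tutte-polynomial : ∀ G x → Polynomial (tutte G x)
tutte-polynomial G x = Polynomial-sum (λ A → (x - 1ℤ) ^ (rank (n G) (edges G) ∸ rank (n G) A)) 1ℤ
                                      (λ A → length A ∸ rank (n G) A) (subsets (edges G))

≡T-off-point : ∀ G H y₀ → (∀ x y → y ≢ y₀ → tutte G x y ≡ tutte H x y) → G ≡T H
≡T-off-point G H y₀ G≡H x y with y ℤ.≟ y₀
... | yes refl = Polynomial-≡-at y₀ (tutte-polynomial G x) (tutte-polynomial H x) (G≡H x)
... | no  y≢y₀ = G≡H x y y≢y₀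

corollary2p3 : (G H : Graph) (e₁ e₂ : Edge G) (f₁ f₂ : Edge H)
    → e₁ ≢ e₂ → Parallel G e₁ e₂
    → f₁ ≢ f₂ → Parallel H f₁ f₂
    → Connected (delete2 G e₁ e₂) → Connected (delete2 H f₁ f₂)
    → (delete2 G e₁ e₂ ≡T delete2 H f₁ f₂ → delete1 G e₁ ≡T delete1 H f₁ → G ≡T H)
    × (delete2 G e₁ e₂ ≡T delete2 H f₁ f₂ → G ≡T H → delete1 G e₁ ≡T delete1 H f₁)
    × (delete1 G e₁ ≡T delete1 H f₁ → G ≡T H → delete2 G e₁ e₂ ≡T delete2 H f₁ f₂)
corollary2p3 G H e₁ e₂ f₁ f₂ e₁≢e₂ e₁∥e₂ f₁≢f₂ f₁∥f₂ G-connected H-connected =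
    (λ T₂≡ T₁≡ x y →
       trans (rec-G x y) (trans (cong₂ (parallelRHS y) (T₁≡ x y) (T₂≡ x y)) (sym (rec-H x y))))
  , (λ T₂≡ T≡ → ≡T-off-point (delete1 G e₁) (delete1 H f₁) -1ℤ λ x y y≢-1 →
       parallelRHS-injectiveˡ y≢-1 (trans (rhs-≡ T≡ x y) (cong (parallelRHS y _) (sym (T₂≡ x y)))))
  , (λ T₁≡ T≡ → ≡T-off-point (delete2 G e₁ e₂) (delete2 H f₁ f₂) 0ℤ λ x y y≢0 →
       parallelRHS-injectiveʳ y≢0 (trans (rhs-≡ T≡ x y) (cong (λ t → parallelRHS y t _) (sym (T₁≡ x y)))))
  where
  rec-G : ∀ x y → tutte G x y ≡ parallelRHS y (tutte (delete1 G e₁) x y) (tutte (delete2 G e₁ e₂) x y)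
  rec-G = tutte-parallel G e₁ e₂ e₁≢e₂ e₁∥e₂ G-connected
  rec-H : ∀ x y → tutte H x y ≡ parallelRHS y (tutte (delete1 H f₁) x y) (tutte (delete2 H f₁ f₂) x y)
  rec-H = tutte-parallel H f₁ f₂ f₁≢f₂ f₁∥f₂ H-connected
  rhs-≡ : G ≡T H → ∀ x y → parallelRHS y (tutte (delete1 G e₁) x y) (tutte (delete2 G e₁ e₂) x y)
                         ≡ parallelRHS y (tutte (delete1 H f₁) x y) (tutte (delete2 H f₁ f₂) x y)
  rhs-≡ T≡ x y = trans (sym (rec-G x y)) (trans (T≡ x y) (rec-H x y))
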